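{- For all $n\in\omega$, ${\sf FIL}\vdash\mathsf R^n$, where for arbitrary ${\sf FIL}$-formulas $A,B,C,D_1,D_2,\dots$: $\mathsf U_1:=\Diamond\neg(D_1\rhd\neg C)$, $\mathsf U_{n+1}:=\Diamond((D_n\rhd D_{n+1})\wedge\mathsf U_n)$ for $n\ge1$; $\mathsf R^0:=A\rhd B\to\neg(A\rhd\neg C)\rhd B\wedge\Box C$ and $\mathsf R^{n+1}:=A\rhd B\to(\mathsf U_{n+1}\wedge(D_{n+1}\rhd A))\rhd B\wedge\Box C$.
   Context: The logic ${\sf FIL}$: the language has propositional variables, interpretation variables $k_0,k_1,\dots$, one interpretation constant ${\sf id}$, $\top,\bot$, Boolean connectives and modalities $\Box^{\mathfrak a}A$, $A\rhd^{\mathfrak a}B$ where $\mathfrak a$ is a finite sequence of interpretation terms without repetition; unlabelled $\Box,\rhd$ stand for label ${\sf id}$ / the empty sequence; $\Diamond^{\mathfrak a}:=\neg\Box^{\mathfrak a}\neg$; $\mathfrak a,k$ is $\mathfrak a$ extended by $k$. Sequents $\Gamma\vdash C$ with $\Gamma$ a multiset, with $\Gamma,\Delta\vdash C$ iff $\Delta\vdash\bigwedge\Gamma\to C$. Axioms/rules (for all labels $\mathfrak a,\mathfrak b$, terms $k$): all tautologies; modus ponens; $\Box^{\mathfrak a}(A\to B)\to(\Box^{\mathfrak a}A\to\Box^{\mathfrak a}B)$; $\Box^{\mathfrak b}A\to\Box^{\mathfrak a}\Box^{\mathfrak b}A$; $\Box^{\mathfrak a}(\Box^{\mathfrak a}A\to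 A)\to\Box^{\mathfrak a}A$; $\Box^{\mathfrak a}(A\to B)\to A\rhd^{\mathfrak a}B$; $(A\rhd B)\wedge(B\rhd^{\mathfrak a}C)\to A\rhd^{\mathfrak a}C$; $(A\rhd^{\mathfrak a}B)\wedge\Box^{\mathfrak a}(B\to C)\to A\rhd^{\mathfrak a}C$; $(A\rhd^{\mathfrak a}C)\wedge(B\rhd^{\mathfrak a}C)\to A\vee B\rhd^{\mathfrak a}C$; $A\rhd^{\mathfrak a}B\to(\Diamond A\to\Diamond^{\mathfrak a}B)$; $A\rhd^{\mathfrak a}\Diamond^{\mathfrak b}B\to A\rhd^{\mathfrak b}B$; $\Box^{\mathfrak a,k}A\to\Box^{\mathfrak a}A$; $A\rhd^{\mathfrak a}B\to A\rhd^{\mathfrak a,k}B$; necessitation $\vdash A\Rightarrow\vdash\Box^{\mathfrak a}A$; rule $\mathsf P^{\mathfrak a,\mathfrak b,k}$: from $\Gamma,\Delta,\Box^{\mathfrak b}(A\rhd^{\mathfrak a,k}B)\vdash C$ infer $\Gamma,A\rhd^{\mathfrak a}B\vdash C$, provided $k$ is an interpretation variable not occurring in $\mathfrak a,\Gamma,A,B,C$ and $\Delta$ consists of formulas of the forms $E\rhd^{\mathfrak a,k}F\to E\rhd^{\mathfrak a}F$ and $\Box^{\mathfrak a}E\to\Box^{\mathfrak a,k}E$. Binding: $\neg,\Box,\Diamond$ strongest, Boolean connectives other than $\to$ bind stronger than $\rhd$, $\rhd$ stronger than $\to$. -}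

module Defs where

open import Data.Nat using (ℕ; zero; suc)
open import Data.Bool using (Bool; true; false; not; _∧_; _∨_; T; if_then_else_)
open import Data.List using (List; []; _∷_; _++_; _∷ʳ_)
open import Data.List.Membership.Propositional using (_∈_; _∉_)
open import Data.List.Relation.Unary.All using (All)
open import Data.Product using (Σ; ∃; ∃₂; _×_; _,_)
open import Data.Sum using (_⊎_)
open import Data.Unit using (tt)
open import Relation.Binary.PropositionalEquality using (_≡_)
import Data.Nat as ℕ

-- Interpretation terms: variables k₀, k₁, … and the constant id

data ITerm : Set where
  ivar : ℕ → ITerm
  idc  : ITerm

eqT : ITerm → ITerm → Bool
eqT (ivar m) (ivar n) = m ℕ.≡ᵇ n
eqT (ivar _) idc      = false
eqT idc      (ivar _) = false
eqT idc      idc      = true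

elemT : ITerm → List ITerm → Bool
elemT x []       = false
elemT x (y ∷ ys) = eqT x y ∨ elemT x ys

nodup : List ITerm → Bool
nodup []       = true
nodup (x ∷ xs) = not (elemT x xs) ∧ nodup xs

record Label : Set where
  constructor mkL
  field
    seq : List ITerm
    nd  : T (nodup seq)
open Label public

ext : (a : Label) (k : ITerm) → T (nodup (seq a ∷ʳ k)) → Label
ext a k p = mkL (seq a ∷ʳ k) p

idL : Label
idL = mkL (idc ∷ []) tt

emptyL : Label
emptyL = mkL [] tt

infixr 4 _⇒_
infixr 5 _∨'_
infixr 6 _∧'_
infixr 6 _▷[_]_

data Form : Set where
  atom   : ℕ → Form
  ⊤'     : Form
  ⊥'     : Form
  ¬'_    : Form → Form
  _∧'_   : Form → Form → Form
  _∨'_   : Form → Form → Form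
  _⇒_    : Form → Form → Form
  □[_]_  : Label → Form → Form
  _▷[_]_ : Form → Label → Form → Form

◇[_]_ : Label → Form → Form
◇[ a ] A = ¬' (□[ a ] (¬' A))

-- unlabelled modalities: □ has label id, ▷ has the empty sequence
□_ : Form → Form
□ A = □[ idL ] A

◇_ : Form → Form
◇ A = ◇[ idL ] A

_▷_ : Form → Form → Form
A ▷ B = A ▷[ emptyL ] B

infixr 6 _▷_

termsOf : Form → List ITerm
termsOf (atom _)      = []
termsOf ⊤'            = []
termsOf ⊥'            = []
termsOf (¬' A)        = termsOf A
termsOf (A ∧' B)      = termsOf A ++ termsOf B
termsOf (A ∨' B)      = termsOf A ++ termsOf B
termsOf (A ⇒ B)       = termsOf A ++ termsOf B
termsOf (□[ a ] A)    = seq a ++ termsOf A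
termsOf (A ▷[ a ] B)  = termsOf A ++ seq a ++ termsOf B

NotIn : ITerm → Form → Set
NotIn k A = k ∉ termsOf A

-- Tautologies: modal formulas and atoms are treated as propositional atoms

eval : (Form → Bool) → Form → Bool
eval v (atom n)     = v (atom n)
eval v ⊤'           = true
eval v ⊥'           = false
eval v (¬' A)       = not (eval v A)
eval v (A ∧' B)     = eval v A ∧ eval v B
eval v (A ∨' B)     = eval v A ∨ eval v B
eval v (A ⇒ B)      = not (eval v A) ∨ eval v B
eval v (□[ a ] A)   = v (□[ a ] A)
eval v (A ▷[ a ] B) = v (A ▷[ a ] B)

Tautology : Form → Set
Tautology A = (v : Form → Bool) → eval v A ≡ true

⋀ : List Form → Form
⋀ []       = ⊤'
⋀ (A ∷ Γ)  = A ∧' ⋀ Γ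

DeltaForm : (a ak : Label) → Form → Set
DeltaForm a ak δ =
    (∃₂ λ E F → δ ≡ ((E ▷[ ak ] F) ⇒ (E ▷[ a ] F)))
  ⊎ (∃ λ E → δ ≡ ((□[ a ] E) ⇒ (□[ ak ] E)))

-- Derivability in FIL  (Γ ⊢ C is encoded as ⊢ ⋀Γ ⇒ C)

infix 2 FIL⊢_

data FIL⊢_ : Form → Set where
  taut : ∀ {A} → Tautology A → FIL⊢ A
  mp   : ∀ {A B} → FIL⊢ A → FIL⊢ (A ⇒ B) → FIL⊢ B
  axK  : ∀ a A B → FIL⊢ (□[ a ] (A ⇒ B) ⇒ (□[ a ] A ⇒ □[ a ] B))
  ax4  : ∀ a b A → FIL⊢ (□[ b ] A ⇒ □[ a ] (□[ b ] A))
  axL  : ∀ a A → FIL⊢ (□[ a ] (□[ a ] A ⇒ A) ⇒ □[ a ] A)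
  axJ1 : ∀ a A B → FIL⊢ (□[ a ] (A ⇒ B) ⇒ (A ▷[ a ] B))
  axJ2 : ∀ a A B C → FIL⊢ ((A ▷ B) ∧' (B ▷[ a ] C) ⇒ (A ▷[ a ] C))
  axJ2' : ∀ a A B C → FIL⊢ ((A ▷[ a ] B) ∧' □[ a ] (B ⇒ C) ⇒ (A ▷[ a ] C))
  axJ3 : ∀ a A B C → FIL⊢ ((A ▷[ a ] C) ∧' (B ▷[ a ] C) ⇒ ((A ∨' B) ▷[ a ] C))
  axJ4 : ∀ a A B → FIL⊢ ((A ▷[ a ] B) ⇒ (◇ A ⇒ ◇[ a ] B))
  axJ5 : ∀ a b A B → FIL⊢ ((A ▷[ a ] (◇[ b ] B)) ⇒ (A ▷[ b ] B))
  axMon□ : ∀ a k (p : T (nodup (seq a ∷ʳ k))) A →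
           FIL⊢ (□[ ext a k p ] A ⇒ □[ a ] A)
  axMon▷ : ∀ a k (p : T (nodup (seq a ∷ʳ k))) A B →
           FIL⊢ ((A ▷[ a ] B) ⇒ (A ▷[ ext a k p ] B))
  nec  : ∀ a {A} → FIL⊢ A → FIL⊢ □[ a ] A
  ruleP : ∀ (a b : Label) (i : ℕ) (p : T (nodup (seq a ∷ʳ ivar i)))
            (Γ Δ : List Form) (A B C : Form) →
          ivar i ∉ seq a →
          All (NotIn (ivar i)) Γ →
          NotIn (ivar i) A → NotIn (ivar i) B → NotIn (ivar i) C →
          All (DeltaForm a (ext a (ivar i) p)) Δ →
          FIL⊢ (⋀ (Γ ++ Δ ++ (□[ b ] (A ▷[ ext a (ivar i) p ] B) ∷ [])) ⇒ C) →
          FIL⊢ (⋀ (Γ ++ (A ▷[ a ] B) ∷ []) ⇒ C)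

-- The principles U_n and R^n.
-- D : ℕ → Form is the sequence D₁, D₂, … (D 0 is not used).
-- Uf n = U_{n+1}.

Uf : (C : Form) (D : ℕ → Form) → ℕ → Form
Uf C D zero    = ◇ (¬' (D 1 ▷ ¬' C))
Uf C D (suc n) = ◇ ((D (suc n) ▷ D (suc (suc n))) ∧' Uf C D n)

R : ℕ → (A B C : Form) (D : ℕ → Form) → Form
R zero    A B C D = (A ▷ B) ⇒ ((¬' (A ▷ ¬' C)) ▷ (B ∧' □ C))
R (suc n) A B C D = (A ▷ B) ⇒ ((Uf C D n ∧' (D (suc n) ▷ A)) ▷ (B ∧' □ C))

{-# OPTIONS --safe #-}
module Submission where

-- Write H for B → ◇^∅ ¬C and say that G excludes X when, for every label 𝔞,
-- G ▷^𝔞 B and □^𝔞 H refute X. G excludes ¬(G ▷ ¬C) by J2' and J5; exclusion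
-- by P passes to (P ▷ G) ∧ Z by J2; and rule P lets it pass under ◇: a fresh
-- extension 𝔞,k inherits □^𝔞 H, and □(G ▷^{𝔞,k} B) then yields □¬X. So D_{n+1}
-- excludes U_{n+1}, and A excludes the antecedent of R^n. Finally, if A excludes
-- X, rule P with 𝔞 = ∅ turns A ▷ B into X ▷ B ∧ □C: from □(A ▷^k B) we get
-- X → ◇^k(B ∧ □C), because ¬(B ∧ □C) implies H, hence X ▷^k B ∧ □C by J1 and J5.

open import Defs
open import Data.Nat using (ℕ; zero; suc)
open import Data.Nat.Properties using (≡ᵇ⇒≡; 1+n≰n)
open import Data.Bool using (Bool; true; false; not; _∧_; _∨_; T)
open import Data.Bool.Properties using (T-∧; T-≡; ¬-not)
open import Data.Fin using (Fin; zero; suc)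
open import Data.Vec using (Vec; []; _∷_; lookup)
import Data.Vec as Vec
open import Data.Vec.Properties using (lookup-map)
open import Data.List using (List; []; _∷_; _∷ʳ_; concat; map)
open import Data.List.Extrema.Nat using (max; xs≤max)
open import Data.List.Membership.Propositional using (_∉_)
open import Data.List.Membership.Propositional.Properties using (∈-map⁺; ∈-concat⁺′)
open import Data.List.Relation.Unary.All as All using (All; []; _∷_)
open import Data.List.Relation.Unary.Any using (here; there)
open import Data.Product using (∃; _,_)
open import Data.Sum using (inj₁; inj₂)
open import Function using (_∘_; Equivalence)
open import Relation.Binary.PropositionalEquality using (_≡_; _≢_; refl; sym; trans; cong; cong₂)

open Equivalence using (to; from)

private
  variable
    n : ℕ
    A B C G P W X Z : Form

data Schema (n : ℕ) : Set where
  var  : Fin n → Schema n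
  ⊤ˢ   : Schema n
  ¬ˢ_  : Schema n → Schema n
  _∧ˢ_ : Schema n → Schema n → Schema n
  _⇒ˢ_ : Schema n → Schema n → Schema n

infixr 4 _⇒ˢ_
infixr 6 _∧ˢ_

x₀ : Schema (suc n)
x₀ = var zero

x₁ : Schema (suc (suc n))
x₁ = var (suc zero)

x₂ : Schema (suc (suc (suc n)))
x₂ = var (suc (suc zero))

x₃ : Schema (suc (suc (suc (suc n))))
x₃ = var (suc (suc (suc zero)))

x₄ : Schema (suc (suc (suc (suc (suc n)))))
x₄ = var (suc (suc (suc (suc zero))))

instantiate : Schema n → Vec Form n → Form
instantiate (var i)  ρ = lookup ρ i
instantiate ⊤ˢ       ρ = ⊤'
instantiate (¬ˢ φ)   ρ = ¬' instantiate φ ρ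
instantiate (φ ∧ˢ ψ) ρ = instantiate φ ρ ∧' instantiate ψ ρ
instantiate (φ ⇒ˢ ψ) ρ = instantiate φ ρ ⇒ instantiate ψ ρ

evalˢ : Schema n → Vec Bool n → Bool
evalˢ (var i)  σ = lookup σ i
evalˢ ⊤ˢ       σ = true
evalˢ (¬ˢ φ)   σ = not (evalˢ φ σ)
evalˢ (φ ∧ˢ ψ) σ = evalˢ φ σ ∧ evalˢ ψ σ
evalˢ (φ ⇒ˢ ψ) σ = not (evalˢ φ σ) ∨ evalˢ ψ σ

eval-instantiate : ∀ (φ : Schema n) ρ v → eval v (instantiate φ ρ) ≡ evalˢ φ (Vec.map (eval v) ρ)
eval-instantiate (var i)  ρ v = sym (lookup-map i (eval v) ρ)
eval-instantiate ⊤ˢ       ρ v = refl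
eval-instantiate (¬ˢ φ)   ρ v = cong not (eval-instantiate φ ρ v)
eval-instantiate (φ ∧ˢ ψ) ρ v = cong₂ _∧_ (eval-instantiate φ ρ v) (eval-instantiate ψ ρ v)
eval-instantiate (φ ⇒ˢ ψ) ρ v = cong₂ (λ x y → not x ∨ y) (eval-instantiate φ ρ v) (eval-instantiate ψ ρ v)

allTrue : ∀ n → (Vec Bool n → Bool) → Bool
allTrue zero    f = f []
allTrue (suc n) f = allTrue n (f ∘ (true ∷_)) ∧ allTrue n (f ∘ (false ∷_))

allTrue-sound : ∀ n f → T (allTrue n f) → ∀ σ → T (f σ)
allTrue-sound zero    f h []          = h
allTrue-sound (suc n) f h (true  ∷ σ) with to T-∧ h
... | h₁ , _ = allTrue-sound n (f ∘ (true ∷_)) h₁ σ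
allTrue-sound (suc n) f h (false ∷ σ) with to T-∧ h
... | _ , h₂ = allTrue-sound n (f ∘ (false ∷_)) h₂ σ

tautology : (φ : Schema n) (ρ : Vec Form n) {valid : T (allTrue n (evalˢ φ))} →
            FIL⊢ instantiate φ ρ
tautology {n} φ ρ {valid} = taut λ v →
  trans (eval-instantiate φ ρ v) (to T-≡ (allTrue-sound n (evalˢ φ) valid (Vec.map (eval v) ρ)))

mp₂ : FIL⊢ A → FIL⊢ B → FIL⊢ (A ⇒ B ⇒ C) → FIL⊢ C
mp₂ ⊢A ⊢B ⊢A⇒B⇒C = mp ⊢B (mp ⊢A ⊢A⇒B⇒C)

infixr 1 _⨾_

_⨾_ : FIL⊢ (A ⇒ B) → FIL⊢ (B ⇒ C) → FIL⊢ (A ⇒ C)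
_⨾_ {A} {B} {C} ⊢A⇒B ⊢B⇒C =
  mp₂ ⊢A⇒B ⊢B⇒C (tautology ((x₀ ⇒ˢ x₁) ⇒ˢ (x₁ ⇒ˢ x₂) ⇒ˢ x₀ ⇒ˢ x₂) (A ∷ B ∷ C ∷ []))

curry : FIL⊢ (A ∧' B ⇒ C) → FIL⊢ (A ⇒ B ⇒ C)
curry {A} {B} {C} h = mp h (tautology ((x₀ ∧ˢ x₁ ⇒ˢ x₂) ⇒ˢ x₀ ⇒ˢ x₁ ⇒ˢ x₂) (A ∷ B ∷ C ∷ []))

contrapose : FIL⊢ (¬' A ⇒ ¬' B) → FIL⊢ (B ⇒ A)
contrapose {A} {B} h = mp h (tautology ((¬ˢ x₀ ⇒ˢ ¬ˢ x₁) ⇒ˢ x₁ ⇒ˢ x₀) (A ∷ B ∷ []))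

¬¬-intro : FIL⊢ (A ⇒ ¬' ¬' A)
¬¬-intro {A} = tautology (x₀ ⇒ˢ ¬ˢ ¬ˢ x₀) (A ∷ [])

¬¬-elim : FIL⊢ (¬' ¬' A ⇒ A)
¬¬-elim {A} = tautology (¬ˢ ¬ˢ x₀ ⇒ˢ x₀) (A ∷ [])

∧-comm : FIL⊢ (A ∧' B ⇒ B ∧' A)
∧-comm {A} {B} = tautology (x₀ ∧ˢ x₁ ⇒ˢ x₁ ∧ˢ x₀) (A ∷ B ∷ [])

□-mono : ∀ a → FIL⊢ (A ⇒ B) → FIL⊢ (□[ a ] A ⇒ □[ a ] B)
□-mono {A} {B} a ⊢A⇒B = mp (nec a ⊢A⇒B) (axK a A B)

□-mono₂ : ∀ a → FIL⊢ (A ⇒ B ⇒ C) → FIL⊢ (□[ a ] A ⇒ □[ a ] B ⇒ □[ a ] C)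
□-mono₂ {B = B} {C} a ⊢A⇒B⇒C = □-mono a ⊢A⇒B⇒C ⨾ axK a B C

◇⇒◇[a] : ∀ a → FIL⊢ (◇ A ⇒ ◇[ a ] A)
◇⇒◇[a] {A} a = mp (mp (nec a (tautology (x₀ ⇒ˢ x₀) (A ∷ []))) (axJ1 a A A)) (axJ4 a A A)

□[a]⇒□ : ∀ a → FIL⊢ (□[ a ] A ⇒ □ A)
□[a]⇒□ {A} a = □-mono a ¬¬-intro ⨾ contrapose (◇⇒◇[a] {¬' A} a) ⨾ □-mono idL ¬¬-elim

eqT-sound : ∀ x y → T (eqT x y) → x ≡ y
eqT-sound (ivar m) (ivar n) h = cong ivar (≡ᵇ⇒≡ m n h)
eqT-sound (ivar _) idc      ()
eqT-sound idc      (ivar _) ()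
eqT-sound idc      idc      _ = refl

eqT-≢ : ∀ x y → x ≢ y → eqT x y ≡ false
eqT-≢ x y x≢y = ¬-not (x≢y ∘ eqT-sound x y ∘ from T-≡)

elemT-∷ʳ : ∀ y ys x → eqT y x ≡ false → elemT y (ys ∷ʳ x) ≡ elemT y ys
elemT-∷ʳ y []       x y≉x = cong (_∨ false) y≉x
elemT-∷ʳ y (z ∷ zs) x y≉x = cong (eqT y z ∨_) (elemT-∷ʳ y zs x y≉x)

nodup-∷ʳ : ∀ xs x → T (nodup xs) → x ∉ xs → T (nodup (xs ∷ʳ x))
nodup-∷ʳ []       x _  _  = _
nodup-∷ʳ (y ∷ ys) x nd x∉
  rewrite elemT-∷ʳ y ys x (eqT-≢ y x (x∉ ∘ here ∘ sym)) with to T-∧ nd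
... | y∉ys , nd-ys = from T-∧ (y∉ys , nodup-∷ʳ ys x nd-ys (x∉ ∘ there))

index : ITerm → ℕ
index (ivar n) = n
index idc      = 0

fresh : (xss : List (List ITerm)) → ∃ λ i → All (ivar i ∉_) xss
fresh xss = suc bound , All.tabulate λ xs∈xss i∈xs →
  1+n≰n (All.lookup (xs≤max 0 _) (∈-map⁺ index (∈-concat⁺′ i∈xs xs∈xss)))
  where
    bound : ℕ
    bound = max 0 (map index (concat xss))

ruleP-∀ : ∀ a b γ A B C (δ : Label → Form) →
          (∀ a′ → DeltaForm a a′ (δ a′)) →
          (∀ a′ → FIL⊢ (□[ b ] (A ▷[ a′ ] B) ⇒ γ ⇒ δ a′ ⇒ C)) →
          FIL⊢ (A ▷[ a ] B ⇒ γ ⇒ C)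
ruleP-∀ a b γ A B C δ δ-ok premise
  with fresh (seq a ∷ termsOf γ ∷ termsOf A ∷ termsOf B ∷ termsOf C ∷ [])
... | i , (i∉a ∷ i∉γ ∷ i∉A ∷ i∉B ∷ i∉C ∷ []) =
  mp (ruleP a b i a,i∉ (γ ∷ []) (δ a′ ∷ []) A B C i∉a (i∉γ ∷ []) i∉A i∉B i∉C (δ-ok a′ ∷ [])
       (mp (premise a′) (tautology ((x₀ ⇒ˢ x₁ ⇒ˢ x₂ ⇒ˢ x₃) ⇒ˢ x₁ ∧ˢ x₂ ∧ˢ x₀ ∧ˢ ⊤ˢ ⇒ˢ x₃)
                                   (□[ b ] (A ▷[ a′ ] B) ∷ γ ∷ δ a′ ∷ C ∷ []))))
     (tautology ((x₁ ∧ˢ x₀ ∧ˢ ⊤ˢ ⇒ˢ x₂) ⇒ˢ x₀ ⇒ˢ x₁ ⇒ˢ x₂) (A ▷[ a ] B ∷ γ ∷ C ∷ []))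
  where
    a,i∉ : T (nodup (seq a ∷ʳ ivar i))
    a,i∉ = nodup-∷ʳ (seq a) (ivar i) (nd a) i∉a
    a′ : Label
    a′ = ext a (ivar i) a,i∉

-- The diamond carries the empty label so that J5 can turn G ▷^𝔞 ◇^∅ ¬C into G ▷ ¬C.
escape : Form → Form → Form
escape B C = B ⇒ ◇[ emptyL ] ¬' C

Excludes : (B C G X : Form) → Set
Excludes B C G X = ∀ a → FIL⊢ (G ▷[ a ] B ⇒ □[ a ] escape B C ⇒ ¬' X)

excludes-¬▷¬ : ∀ G → Excludes B C G (¬' (G ▷ ¬' C))
excludes-¬▷¬ {B} {C} G a = curry (axJ2' a G B (◇[ emptyL ] ¬' C) ⨾ axJ5 a emptyL G (¬' C) ⨾ ¬¬-intro)

excludes-weaken : FIL⊢ (W ⇒ X) → Excludes B C G X → Excludes B C G W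
excludes-weaken {W} {X} {B} {C} {G} ⊢W⇒X ex a =
  mp₂ ⊢W⇒X (ex a) (tautology ((x₀ ⇒ˢ x₁) ⇒ˢ (x₂ ⇒ˢ x₃ ⇒ˢ ¬ˢ x₁) ⇒ˢ x₂ ⇒ˢ x₃ ⇒ˢ ¬ˢ x₀)
                             (W ∷ X ∷ G ▷[ a ] B ∷ □[ a ] escape B C ∷ []))

excludes-▷∧ : Excludes B C P Z → Excludes B C G ((P ▷ G) ∧' Z)
excludes-▷∧ {B} {C} {P} {Z} {G} ex a =
  mp₂ (axJ2 a P G B) (ex a)
      (tautology ((x₀ ∧ˢ x₁ ⇒ˢ x₂) ⇒ˢ (x₂ ⇒ˢ x₃ ⇒ˢ ¬ˢ x₄) ⇒ˢ x₁ ⇒ˢ x₃ ⇒ˢ ¬ˢ (x₀ ∧ˢ x₄))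
                 (P ▷ G ∷ G ▷[ a ] B ∷ P ▷[ a ] B ∷ □[ a ] escape B C ∷ Z ∷ []))

excludes-◇ : Excludes B C G X → Excludes B C G (◇ X)
excludes-◇ {B} {C} {G} {X} ex a =
  ruleP-∀ a idL (□[ a ] H) G B (¬' ◇ X) (λ a′ → □[ a ] H ⇒ □[ a′ ] H) (λ a′ → inj₂ (H , refl))
    λ a′ → mp₂ (□-mono₂ idL (ex a′)) (ax4 idL a′ H)
             (tautology ((x₀ ⇒ˢ x₁ ⇒ˢ x₂) ⇒ˢ (x₃ ⇒ˢ x₁) ⇒ˢ x₀ ⇒ˢ x₄ ⇒ˢ (x₄ ⇒ˢ x₃) ⇒ˢ ¬ˢ ¬ˢ x₂)
                        (□ (G ▷[ a′ ] B) ∷ □ □[ a′ ] H ∷ □ ¬' X ∷ □[ a′ ] H ∷ □[ a ] H ∷ []))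
  where
    H : Form
    H = escape B C

¬∧□⇒escape : FIL⊢ (¬' (B ∧' □ C) ⇒ escape B C)
¬∧□⇒escape {B} {C} =
  mp (□[a]⇒□ emptyL ⨾ □-mono idL ¬¬-elim)
     (tautology ((x₀ ⇒ˢ x₁) ⇒ˢ ¬ˢ (x₂ ∧ˢ x₁) ⇒ˢ x₂ ⇒ˢ ¬ˢ x₀) (□[ emptyL ] ¬' ¬' C ∷ □ C ∷ B ∷ []))

excludes⇒▷ : Excludes B C A X → FIL⊢ (A ▷ B ⇒ X ▷ B ∧' □ C)
excludes⇒▷ {B} {C} {A} {X} ex =
  ruleP-∀ emptyL emptyL ⊤' A B (X ▷ Y) (λ a′ → X ▷[ a′ ] Y ⇒ X ▷ Y) (λ a′ → inj₁ (X , Y , refl))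
    (λ a′ → mp (X▷[a′]Y a′) (tautology ((x₀ ⇒ˢ x₁) ⇒ˢ x₀ ⇒ˢ ⊤ˢ ⇒ˢ (x₁ ⇒ˢ x₂) ⇒ˢ x₂)
                                       (□[ emptyL ] (A ▷[ a′ ] B) ∷ X ▷[ a′ ] Y ∷ X ▷ Y ∷ [])))
  ⨾ tautology ((⊤ˢ ⇒ˢ x₀) ⇒ˢ x₀) (X ▷ Y ∷ [])
  where
    Y : Form
    Y = B ∧' □ C
    X⇒◇[a′]Y : ∀ a′ → FIL⊢ (A ▷[ a′ ] B ⇒ X ⇒ ◇[ a′ ] Y)
    X⇒◇[a′]Y a′ =
      mp₂ (ex a′) (□-mono a′ ¬∧□⇒escape)
          (tautology ((x₀ ⇒ˢ x₁ ⇒ˢ ¬ˢ x₂) ⇒ˢ (x₃ ⇒ˢ x₁) ⇒ˢ x₀ ⇒ˢ x₂ ⇒ˢ ¬ˢ x₃)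
                     (A ▷[ a′ ] B ∷ □[ a′ ] escape B C ∷ X ∷ □[ a′ ] ¬' Y ∷ []))
    X▷[a′]Y : ∀ a′ → FIL⊢ (□[ emptyL ] (A ▷[ a′ ] B) ⇒ X ▷[ a′ ] Y)
    X▷[a′]Y a′ = □-mono emptyL (X⇒◇[a′]Y a′) ⨾ axJ1 emptyL X (◇[ a′ ] Y) ⨾ axJ5 emptyL a′ X Y

excludes-U : (B C : Form) (D : ℕ → Form) → ∀ m → Excludes B C (D (suc m)) (Uf C D m)
excludes-U B C D zero    = excludes-◇ (excludes-¬▷¬ (D 1))
excludes-U B C D (suc m) = excludes-◇ (excludes-▷∧ (excludes-U B C D m))

mainTheorem3 : (n : ℕ) (A B C : Form) (D : ℕ → Form) → FIL⊢ R n A B C D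
mainTheorem3 zero    A B C D = excludes⇒▷ (excludes-¬▷¬ A)
mainTheorem3 (suc m) A B C D = excludes⇒▷ (excludes-weaken ∧-comm (excludes-▷∧ (excludes-U B C D m)))
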